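{- (i) Let $L$ be a model, and for $x\in L$, $\alpha<\kappa$ let $x|_\alpha$ be the unique element with $x|_\alpha=_\alpha x$ and such that $x\sqsubseteq_\alpha y$ implies $x|_\alpha\leq y$ for all $y\in L$ (condition C). Then the maps $|_\alpha:L\to L$ satisfy: (B1) $(x|_\alpha)|_\beta=x|_\beta$ for all $x$ and $\beta\leq\alpha<\kappa$; (B2) $x\leq y$ implies $x|_\alpha\leq y|_\alpha$; (B3) $x=\bigvee_{\alpha<\kappa}x|_\alpha$ for all $x$; (B4) for all $\alpha<\kappa$, $y\in L$ and nonempty families $(x_i)_{i\in I}$ with $x_i|_\alpha=y$ for all $i$, $(\bigvee_i x_i)|_\alpha=y$; and moreover (D): for all $\alpha<\kappa$ and $x,y\in L$, $x\sqsubseteq_\alpha y$ iff $x|_\alpha\leq y|_\alpha$ and $x|_\beta=y|_\beta$ for all $\beta<\alpha$. (ii) Conversely, let $(L,\leq)$ be a complete lattice with functions $|_\alpha:L\to L$, $\alpha<\kappa$, satisfying B1–B4, and define relations $\sqsubseteq_\alpha$ by condition D. Then $(L,\leq,(\sqsubseteq_\alpha)_{\alpha<\kappa})$ is a model, and condition C holds (i.e., for each $x,\alpha$, the given $x|_\alpha$ satisfies $x|_\alpha=_\alpha x$ and $x\sqsubseteq_\alpha y\Rightarrow x|_\alpha\leq y$).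
   Context: Fix a limit ordinal $\kappa$. A stratified complete lattice is $(L,\leq,(\sqsubseteq_\alpha)_{\alpha<\kappa})$ with $(L,\leq)$ a complete lattice and each $\sqsubseteq_\alpha$ a preorder; $x=_\alpha y$ means $x\sqsubseteq_\alpha y$ and $y\sqsubseteq_\alpha x$. A model satisfies: (A1) for $\alpha<\beta<\kappa$, $x\sqsubseteq_\beta y$ implies $x=_\alpha y$; (A2) if $x=_\alpha y$ for all $\alpha$ then $x=y$; (A3) for all $x,\alpha$ there is $y$ with $x=_\alpha y$ such that for all $z$, $x\sqsubseteq_\alpha z$ implies $y\leq z$ (such $y$ is unique); (A4) for nonempty $I$ and $x_i=_\alpha y$ ($i\in I$), $\bigvee_i x_i=_\alpha y$; (A5) $x\leq y$ implies $x|_\alpha\leq y|_\alpha$, where $x|_\alpha$ is the element given by A3; (A6) if $x\leq y$ and $x=_\beta y$ for all $\beta<\alpha$ then $x\sqsubseteq_\alpha y$. -}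

module Defs where

open import Data.Product using (Σ; ∃; _×_; _,_; proj₁; proj₂)
open import Data.Sum using (_⊎_)
open import Relation.Binary.PropositionalEquality using (_≡_)
open import Relation.Binary.Structures using (IsPartialOrder; IsPreorder; IsStrictTotalOrder)
open import Induction.WellFounded using (WellFounded)

-- The ordinals below a limit ordinal κ, presented as a well-ordered set
-- (strict total order, well-founded) which is nonempty and has no maximum.
record LimitOrdinal : Set₁ where
  field
    Ord                : Set
    _<_                : Ord → Ord → Set
    isStrictTotalOrder : IsStrictTotalOrder _≡_ _<_
    wellFounded        : WellFounded _<_
    nonzero            : Ord
    noMax              : ∀ α → ∃ λ β → α < β

  _≤ₒ_ : Ord → Ord → Set
  α ≤ₒ β = α < β ⊎ α ≡ β

record CompleteLattice : Set₁ where
  field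
    Carrier        : Set
    _≤_            : Carrier → Carrier → Set
    isPartialOrder : IsPartialOrder _≡_ _≤_
    ⋁              : {I : Set} → (I → Carrier) → Carrier
    ⋁-upper        : {I : Set} (f : I → Carrier) (i : I) → f i ≤ ⋁ f
    ⋁-least        : {I : Set} (f : I → Carrier) (z : Carrier) →
                     (∀ i → f i ≤ z) → ⋁ f ≤ z

module Theory (κ : LimitOrdinal) (L : CompleteLattice) where
  open LimitOrdinal κ
  open CompleteLattice L

  Strat : Set₁
  Strat = Ord → Carrier → Carrier → Set

  Eqα : Strat → Ord → Carrier → Carrier → Set
  Eqα ⊑ α x y = ⊑ α x y × ⊑ α y x

  record IsModel (⊑ : Strat) : Set₁ where
    field
      preorder : ∀ α → IsPreorder _≡_ (⊑ α)
      A1 : ∀ {α β} x y → α < β → ⊑ β x y → Eqα ⊑ α x y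
      A2 : ∀ x y → (∀ α → Eqα ⊑ α x y) → x ≡ y
      A3 : ∀ x α → Σ Carrier λ y → Eqα ⊑ α x y × (∀ z → ⊑ α x z → y ≤ z)
      A4 : ∀ α {I : Set} → I → (xs : I → Carrier) (y : Carrier) →
           (∀ i → Eqα ⊑ α (xs i) y) → Eqα ⊑ α (⋁ xs) y
      A5 : ∀ α x y → x ≤ y → proj₁ (A3 x α) ≤ proj₁ (A3 y α)
      A6 : ∀ α x y → x ≤ y → (∀ β → β < α → Eqα ⊑ β x y) → ⊑ α x y

  Restr : Set
  Restr = Ord → Carrier → Carrier

  CondC : Strat → Restr → Set
  CondC ⊑ r = ∀ α x → Eqα ⊑ α (r α x) x × (∀ y → ⊑ α x y → r α x ≤ y)

  B1 : Restr → Set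
  B1 r = ∀ x α β → β ≤ₒ α → r β (r α x) ≡ r β x

  B2 : Restr → Set
  B2 r = ∀ α x y → x ≤ y → r α x ≤ r α y

  B3 : Restr → Set
  B3 r = ∀ x → x ≡ ⋁ (λ (α : Ord) → r α x)

  B4 : Restr → Set₁
  B4 r = ∀ α (y : Carrier) {I : Set} → I → (xs : I → Carrier) →
         (∀ i → r α (xs i) ≡ y) → r α (⋁ xs) ≡ y

  DRel : Restr → Strat
  DRel r α x y = r α x ≤ r α y × (∀ β → β < α → r β x ≡ r β y)

  CondD : Strat → Restr → Set
  CondD ⊑ r = ∀ α x y → (⊑ α x y → DRel r α x y) × (DRel r α x y → ⊑ α x y)

module Submission where

-- (i) In a model, the restriction x|_α (the ≤-least element ⊒_α-above x that
--     is =_α x) determines =_α completely: x =_α y iff x|_α ≡ y|_α.  Together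
--     with A1 (x|_α =_β x for β < α) this gives B1 and B4; B2 is A5 once
--     x|_α is identified with the witness of A3; B3 follows from A2, since
--     the join of the tail family (x|_β)_{β ≥ α} is =_α x by A4 and equals
--     the full join ⋁_β x|_β because x|_β grows with β.  Condition D is
--     obtained from A1 in one direction and from A6 in the other.
-- (ii) Given B1–B4 and ⊑_α defined by D, the key fact is that x =_α y iff
--     x and y have the same restrictions at every β ≤ α.  Every model axiom
--     then reduces to an equation between restrictions (B1 and B4 do the
--     work), and x|_α ≤ x (a consequence of B3) gives leastness in A3 and C.

open import Defs
open import Data.Product using (_×_; Σ; _,_; proj₁; proj₂)
open import Data.Sum using (inj₁; inj₂)
open import Relation.Binary.PropositionalEquality
  using (_≡_; refl; sym; trans; subst; subst₂; isEquivalence)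
open import Relation.Binary.Structures using (IsPartialOrder; IsPreorder; IsStrictTotalOrder)
open import Relation.Binary.Definitions using (tri<; tri≈; tri>)

module Correspondence (κ : LimitOrdinal) (L : CompleteLattice) where
  open LimitOrdinal κ
  open CompleteLattice L
  open Theory κ L
  module PO = IsPartialOrder isPartialOrder
  module STO = IsStrictTotalOrder isStrictTotalOrder

  ⋁-dominated : {I J : Set} (f : I → Carrier) (g : J → Carrier) →
                (∀ i → Σ J λ j → f i ≤ g j) → ⋁ f ≤ ⋁ g
  ⋁-dominated f g dom =
    ⋁-least f (⋁ g) λ i → PO.trans (proj₂ (dom i)) (⋁-upper g (proj₁ (dom i)))

  -- The ordinals at or above α; restricting a family to them is what lets
  -- A4 be applied at level α.
  Above : Ord → Set
  Above α = Σ Ord (α ≤ₒ_)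

  module FromModel (⊑ : Strat) (M : IsModel ⊑) (r : Restr) (C : CondC ⊑ r) where
    open IsModel M

    ⊑-refl : ∀ α {x} → ⊑ α x x
    ⊑-refl α = IsPreorder.refl (preorder α)

    ⊑-trans : ∀ α {x y z} → ⊑ α x y → ⊑ α y z → ⊑ α x z
    ⊑-trans α = IsPreorder.trans (preorder α)

    =α-sym : ∀ {α x y} → Eqα ⊑ α x y → Eqα ⊑ α y x
    =α-sym (xy , yx) = yx , xy

    =α-trans : ∀ {α x y z} → Eqα ⊑ α x y → Eqα ⊑ α y z → Eqα ⊑ α x z
    =α-trans {α} (xy , yx) (yz , zy) = ⊑-trans α xy yz , ⊑-trans α zy yx

    restr-=α : ∀ α x → Eqα ⊑ α (r α x) x
    restr-=α α x = proj₁ (C α x)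

    restr-least : ∀ α x y → ⊑ α x y → r α x ≤ y
    restr-least α x = proj₂ (C α x)

    restr-deflationary : ∀ α x → r α x ≤ x
    restr-deflationary α x = restr-least α x x (⊑-refl α)

    -- x ⊑_α y implies x|_α ≤ y|_α, since y ⊑_α y|_α.
    restr-⊑ : ∀ α x y → ⊑ α x y → r α x ≤ r α y
    restr-⊑ α x y xy = restr-least α x (r α y) (⊑-trans α xy (proj₂ (restr-=α α y)))

    restr-respects-=α : ∀ α x y → Eqα ⊑ α x y → r α x ≡ r α y
    restr-respects-=α α x y (xy , yx) = PO.antisym (restr-⊑ α x y xy) (restr-⊑ α y x yx)

    =α-from-restr : ∀ α x y → r α x ≡ r α y → Eqα ⊑ α x y
    =α-from-restr α x y eq =
      =α-trans (=α-sym (restr-=α α x)) (subst (λ t → Eqα ⊑ α t y) (sym eq) (restr-=α α y))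

    -- The given restriction is the element provided by A3 (they are both
    -- least ⊑_α-upper bounds =_α x).
    restr-is-A3 : ∀ α x → r α x ≡ proj₁ (A3 x α)
    restr-is-A3 α x with A3 x α
    ... | y , (xy , _) , least = PO.antisym (restr-least α x y xy) (least (r α x) (proj₂ (restr-=α α x)))

    restr-=-below : ∀ x {α β} → β ≤ₒ α → Eqα ⊑ β (r α x) x
    restr-=-below x {α} (inj₁ β<α) = A1 (r α x) x β<α (proj₁ (restr-=α α x))
    restr-=-below x {α} (inj₂ refl) = restr-=α α x

    b1 : B1 r
    b1 x α β β≤α = restr-respects-=α β (r α x) x (restr-=-below x β≤α)

    b2 : B2 r
    b2 α x y x≤y = subst₂ _≤_ (sym (restr-is-A3 α x)) (sym (restr-is-A3 α y)) (A5 α x y x≤y)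

    restr-increasing : ∀ x {β α} → β < α → r β x ≤ r α x
    restr-increasing x {β} {α} β<α =
      subst (_≤ r α x) (b1 x α β (inj₁ β<α)) (restr-deflationary β (r α x))

    tail : ∀ α x → Above α → Carrier
    tail α x (β , _) = r β x

    tail-join : ∀ α x → ⋁ (λ (β : Ord) → r β x) ≡ ⋁ (tail α x)
    tail-join α x = PO.antisym (⋁-dominated _ _ dominate) (⋁-dominated _ _ λ i → proj₁ i , PO.refl)
      where
      dominate : ∀ β → Σ (Above α) λ j → r β x ≤ tail α x j
      dominate β with STO.compare β α
      ... | tri< β<α _ _ = (α , inj₂ refl) , restr-increasing x β<α
      ... | tri≈ _ refl _ = (β , inj₂ refl) , PO.refl
      ... | tri> _ _ α<β = (β , inj₁ α<β) , PO.refl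

    tail-join-=α : ∀ α x → Eqα ⊑ α (⋁ (tail α x)) x
    tail-join-=α α x = A4 α (α , inj₂ refl) (tail α x) x λ { (β , α≤β) → restr-=-below x α≤β }

    b3 : B3 r
    b3 x = A2 x (⋁ λ (β : Ord) → r β x) λ α →
      =α-sym (subst (λ t → Eqα ⊑ α t x) (sym (tail-join α x)) (tail-join-=α α x))

    b4 : B4 r
    b4 α y i xs restr≡y = subst (λ t → r α (⋁ xs) ≡ t) y-fixed
      (restr-respects-=α α (⋁ xs) y (A4 α i xs y members-=α))
      where
      members-=α : ∀ j → Eqα ⊑ α (xs j) y
      members-=α j = subst (Eqα ⊑ α (xs j)) (restr≡y j) (=α-sym (restr-=α α (xs j)))
      y-fixed : r α y ≡ y
      y-fixed = subst (λ t → r α t ≡ t) (restr≡y i) (b1 (xs i) α α (inj₂ refl))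

    -- Sufficiency in D: x ⊑_α x|_α ⊑_α y|_α ⊑_α y, the middle step by A6,
    -- because x|_α =_β x =_β y =_β y|_α for every β < α.
    D-sufficient : ∀ α x y → DRel r α x y → ⊑ α x y
    D-sufficient α x y (restr≤ , below) =
      ⊑-trans α (proj₂ (restr-=α α x)) (⊑-trans α middle (proj₁ (restr-=α α y)))
      where
      middle : ⊑ α (r α x) (r α y)
      middle = A6 α (r α x) (r α y) restr≤ λ β β<α →
        =α-trans (restr-=-below x (inj₁ β<α))
          (=α-trans (=α-from-restr β x y (below β β<α))
            (=α-sym (restr-=-below y (inj₁ β<α))))

    d : CondD ⊑ r
    d α x y = (λ xy → restr-⊑ α x y xy , λ β β<α → restr-respects-=α β x y (A1 x y β<α xy))
            , D-sufficient α x y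

  module FromRestrictions (r : Restr) (b1 : B1 r) (b2 : B2 r) (b3 : B3 r) (b4 : B4 r) where
    R : Strat
    R = DRel r

    restr-deflationary : ∀ α x → r α x ≤ x
    restr-deflationary α x = subst (r α x ≤_) (sym (b3 x)) (⋁-upper _ α)

    AgreeUpTo : Ord → Carrier → Carrier → Set
    AgreeUpTo α x y = ∀ β → β ≤ₒ α → r β x ≡ r β y

    =α-from-agree : ∀ α x y → AgreeUpTo α x y → Eqα R α x y
    =α-from-agree α x y agree =
      (PO.reflexive (agree α (inj₂ refl)) , λ β β<α → agree β (inj₁ β<α)) ,
      (PO.reflexive (sym (agree α (inj₂ refl))) , λ β β<α → sym (agree β (inj₁ β<α)))

    agree-from-=α : ∀ α x y → Eqα R α x y → AgreeUpTo α x y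
    agree-from-=α α x y ((xy , _) , (yx , _)) .α (inj₂ refl) = PO.antisym xy yx
    agree-from-=α α x y ((_ , below) , _) β (inj₁ β<α) = below β β<α

    preorder : ∀ α → IsPreorder _≡_ (R α)
    preorder α = record
      { isEquivalence = isEquivalence
      ; reflexive = λ { refl → PO.refl , λ _ _ → refl }
      ; trans = λ (xy , xy-below) (yz , yz-below) →
          PO.trans xy yz , λ β β<α → trans (xy-below β β<α) (yz-below β β<α)
      }

    a1 : ∀ {α β} x y → α < β → R β x y → Eqα R α x y
    a1 {α} x y α<β (_ , below) = =α-from-agree α x y λ where
      γ (inj₁ γ<α) → below γ (STO.trans γ<α α<β)
      γ (inj₂ refl) → below γ α<β

    -- x ⊑_α y at every level forces x ≤ y, as x = ⋁_α x|_α by B3.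
    ≤-from-⊑-everywhere : ∀ x y → (∀ α → R α x y) → x ≤ y
    ≤-from-⊑-everywhere x y xy = subst₂ _≤_ (sym (b3 x)) (sym (b3 y))
      (⋁-dominated _ _ λ α → α , proj₁ (xy α))

    a2 : ∀ x y → (∀ α → Eqα R α x y) → x ≡ y
    a2 x y eq = PO.antisym (≤-from-⊑-everywhere x y (λ α → proj₁ (eq α)))
                           (≤-from-⊑-everywhere y x (λ α → proj₂ (eq α)))

    -- x =_α x|_α: by B1 they agree at every level β ≤ α.
    =α-restr : ∀ α x → Eqα R α x (r α x)
    =α-restr α x = =α-from-agree α x (r α x) λ β β≤α → sym (b1 x α β β≤α)

    restr-least : ∀ α x y → R α x y → r α x ≤ y
    restr-least α x y (restr≤ , _) = PO.trans restr≤ (restr-deflationary α y)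

    a4 : ∀ α {I : Set} → I → (xs : I → Carrier) (y : Carrier) →
         (∀ i → Eqα R α (xs i) y) → Eqα R α (⋁ xs) y
    a4 α i xs y eq = =α-from-agree α (⋁ xs) y λ β β≤α →
      b4 β (r β y) i xs λ j → agree-from-=α α (xs j) y (eq j) β β≤α

    a6 : ∀ α x y → x ≤ y → (∀ β → β < α → Eqα R β x y) → R α x y
    a6 α x y x≤y eq = b2 α x y x≤y , λ β β<α → agree-from-=α β x y (eq β β<α) β (inj₂ refl)

    model : IsModel R
    model = record
      { preorder = preorder
      ; A1 = a1
      ; A2 = a2
      ; A3 = λ x α → r α x , =α-restr α x , restr-least α x
      ; A4 = a4
      ; A5 = b2
      ; A6 = a6
      }

    condC : CondC R r
    condC α x = (proj₂ (=α-restr α x) , proj₁ (=α-restr α x)) , restr-least α x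

theorem1 : (κ : LimitOrdinal) (L : CompleteLattice) →
           let open Theory κ L in
           ((⊑ : Strat) → IsModel ⊑ → (r : Restr) → CondC ⊑ r →
              B1 r × B2 r × B3 r × B4 r × CondD ⊑ r)
           × ((r : Restr) → B1 r → B2 r → B3 r → B4 r →
              IsModel (DRel r) × CondC (DRel r) r)
theorem1 κ L = modelToRestrictions , restrictionsToModel
  where
  open Correspondence κ L
  open Theory κ L

  modelToRestrictions : (⊑ : Strat) → IsModel ⊑ → (r : Restr) → CondC ⊑ r →
                        B1 r × B2 r × B3 r × B4 r × CondD ⊑ r
  modelToRestrictions ⊑ M r C = b1 , b2 , b3 , b4 , d
    where open FromModel ⊑ M r C

  restrictionsToModel : (r : Restr) → B1 r → B2 r → B3 r → B4 r →
                        IsModel (DRel r) × CondC (DRel r) r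
  restrictionsToModel r b1 b2 b3 b4 = model , condC
    where open FromRestrictions r b1 b2 b3 b4
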